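{- For a normalized DNF over the variables $x_{i,j}$ ($i,j\in[n]$): (1) total orders whose first element is $1$ can only be accepted by terms $[\![T]\!]_\pi$ with $\pi(1)=1$; (2) for $i\neq1$, total orders whose first element is $i$ and second element is $1$ can only be accepted by terms $[\![T]\!]_\pi$ with either ($\pi(1)=1$ and $i\notin T$), or ($\pi(1)=i$ and $\pi(2)=1$).
   Context: A total order on $[n]$ is identified with the assignment $x_{i,j}=1$ iff $i$ precedes $j$; a term accepts a total order if this assignment satisfies it. For $T\subseteq[n]$, $|T|\ge2$, and a bijection $\pi:[|T|]\to T$, $[\![T]\!]_\pi$ is the term $x_{\pi(1),\pi(2)}x_{\pi(2),\pi(3)}\cdots x_{\pi(|T|-1),\pi(|T|)}$ (it accepts exactly the total orders that order the elements of $T$ as $\pi(1),\pi(2),\dots,\pi(|T|)$). A DNF is normalized if every term is of the form $[\![T]\!]_\pi$ for some $T$ containing $1$, and all terms have the same support size $|T|$. -}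

module Defs where

open import Data.Nat using (ℕ; suc; _<_)
open import Data.Fin using (Fin; zero; suc; toℕ; inject₁)
open import Data.Fin.Permutation using (Permutation′; _⟨$⟩ˡ_)
open import Data.Product using (_×_; Σ; ∃; _,_)
open import Data.List using (List)
open import Data.List.Relation.Unary.All using (All)
open import Data.Vec using (Vec; tabulate; toList)
open import Function.Definitions using (Injective)
open import Relation.Binary.PropositionalEquality using (_≡_)

-- Elements of [n] are Fin (suc n); the element "1" of the paper is `zero`.
-- A literal x_{i,j} is the pair (i , j); a term is a conjunction (list) of
-- literals; a DNF is a disjunction (list) of terms.
Literal : ℕ → Set
Literal n = Fin (suc n) × Fin (suc n)

Term : ℕ → Set
Term n = List (Literal n)

DNF : ℕ → Set
DNF n = List (Term n)

-- A total order on [n] given by a permutation σ mapping positions to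
-- elements; i precedes j iff the position of i is smaller than that of j.
TotalOrder : ℕ → Set
TotalOrder n = Permutation′ (suc n)

Precedes : ∀ {n} → TotalOrder n → Fin (suc n) → Fin (suc n) → Set
Precedes σ i j = toℕ (σ ⟨$⟩ˡ i) < toℕ (σ ⟨$⟩ˡ j)

SatLit : ∀ {n} → TotalOrder n → Literal n → Set
SatLit σ (i , j) = Precedes σ i j

Accepts : ∀ {n} → Term n → TotalOrder n → Set
Accepts t σ = All (SatLit σ) t

-- [[T]]_π for |T| = suc (suc k), π : [|T|] → T ⊆ [n] injective (T = image π):
-- the term x_{π(1),π(2)} ... x_{π(|T|-1),π(|T|)}.
chain : ∀ {n k} → (Fin (suc (suc k)) → Fin (suc n)) → Term n
chain {k = k} π = toList (tabulate {n = suc k} (λ a → (π (inject₁ a) , π (suc a))))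

InImage : ∀ {n k} → (Fin k → Fin (suc n)) → Fin (suc n) → Set
InImage π i = ∃ λ a → π a ≡ i

Normalized : ∀ {n} → DNF n → Set
Normalized {n} D = ∃ λ k → All (λ t → Σ (Fin (suc (suc k)) → Fin (suc n)) λ π →
                     Injective _≡_ _≡_ π × InImage π zero × t ≡ chain π) D

IsFirst : ∀ {n} → TotalOrder n → Fin (suc n) → Set
IsFirst σ i = toℕ (σ ⟨$⟩ˡ i) ≡ 0

IsSecond : ∀ {n} → TotalOrder n → Fin (suc n) → Set
IsSecond σ i = toℕ (σ ⟨$⟩ˡ i) ≡ 1

{-# OPTIONS --safe #-}
module Submission where

-- Acceptance of the chain
-- x_{π(1),π(2)} ⋯ x_{π(m-1),π(m)} says that positions strictly increase along π,
-- so π(b+1) sits at least b positions after π(1). Hence the element in first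
-- position can only be π(1), and the element in second position can only be
-- π(1) or π(2), in the latter case with π(1) in first position. Since 1 ∈ T for
-- every term of a normalized DNF, both claims follow by locating 1 in π.

open import Defs
open import Data.Nat using (ℕ; suc; _+_; _≤_; _<_; s≤s)
open import Data.Nat.Properties using (≤-reflexive; ≤-trans; +-identityʳ; +-suc; +-monoˡ-≤; +-cancelʳ-≤; m+n≤o⇒n≤o; n≤0⇒n≡0)
open import Data.Fin using (Fin; zero; suc; toℕ; inject₁)
open import Data.Fin.Properties using (toℕ-injective)
open import Data.Fin.Permutation using (_⟨$⟩ˡ_; _⟨$⟩ʳ_; inverseʳ)
open import Data.Product using (_×_; _,_; proj₁; proj₂)
open import Data.Sum using (_⊎_; inj₁; inj₂)
open import Data.List.Relation.Unary.All as All using ()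
open import Data.List.Relation.Unary.Any using (Any)
open import Data.List.Membership.Propositional using (_∈_)
open import Data.Vec using (tabulate)
open import Data.Vec.Relation.Unary.All.Properties as VecAll using ()
open import Data.Vec.Relation.Unary.Any.Properties as VecAny using ()
open import Function.Definitions using (Injective)
open import Relation.Binary.PropositionalEquality using (_≡_; _≢_; refl; sym; trans; cong; subst; module ≡-Reasoning)
open import Relation.Nullary using (¬_)

Occurs : ∀ {n} → Fin (suc n) → Term n → Set
Occurs x t = Any (λ l → x ≡ proj₁ l ⊎ x ≡ proj₂ l) t

module _ {n k : ℕ} (π : Fin (suc (suc k)) → Fin (suc n)) where

  links : Fin (suc k) → Literal n
  links a = π (inject₁ a) , π (suc a)

  InImage⇒Occurs-chain : ∀ {x} → InImage π x → Occurs x (chain π)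
  InImage⇒Occurs-chain (zero  , refl) = VecAny.toList⁺ (VecAny.tabulate⁺ {f = links} zero (inj₁ refl))
  InImage⇒Occurs-chain (suc a , refl) = VecAny.toList⁺ (VecAny.tabulate⁺ {f = links} a (inj₂ refl))

  Occurs-chain⇒InImage : ∀ {x} → Occurs x (chain π) → InImage π x
  Occurs-chain⇒InImage o with VecAny.tabulate⁻ (VecAny.toList⁻ {xs = tabulate links} o)
  ... | a , inj₁ x≡πa = inject₁ a , sym x≡πa
  ... | a , inj₂ x≡πa = suc a , sym x≡πa

chain≡⇒InImage : ∀ {n k l} {π : Fin (suc (suc k)) → Fin (suc n)} {ρ : Fin (suc (suc l)) → Fin (suc n)} {x} →
                 chain π ≡ chain ρ → InImage ρ x → InImage π x
chain≡⇒InImage {π = π} {ρ} π≡ρ x∈ρ =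
  Occurs-chain⇒InImage π (subst (Occurs _) (sym π≡ρ) (InImage⇒Occurs-chain ρ x∈ρ))

Normalized⇒zero∈image : ∀ {n} {D : DNF n} → Normalized D → ∀ {t} → t ∈ D →
                        ∀ {k} {π : Fin (suc (suc k)) → Fin (suc n)} → t ≡ chain π → InImage π zero
Normalized⇒zero∈image (_ , terms) t∈D t≡π with All.lookup terms t∈D
... | _ , _ , zero∈ρ , t≡ρ = chain≡⇒InImage (trans (sym t≡π) t≡ρ) zero∈ρ

increasing⇒stride : ∀ {m} (g : Fin (suc m) → ℕ) → (∀ a → g (inject₁ a) < g (suc a)) →
                    ∀ b → g zero + toℕ b ≤ g b
increasing⇒stride g inc zero = ≤-reflexive (+-identityʳ (g zero))
increasing⇒stride {suc m} g inc (suc b) = begin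
  g zero + suc (toℕ b)       ≡⟨ +-suc (g zero) (toℕ b) ⟩
  suc (g zero) + toℕ b       ≤⟨ +-monoˡ-≤ (toℕ b) (inc zero) ⟩
  g (suc zero) + toℕ b       ≤⟨ increasing⇒stride (λ a → g (suc a)) (λ a → inc (suc a)) b ⟩
  g (suc b)                  ∎
  where open Data.Nat.Properties.≤-Reasoning

module _ {n : ℕ} (σ : TotalOrder n) where

  position : Fin (suc n) → ℕ
  position x = toℕ (σ ⟨$⟩ˡ x)

  position-injective : Injective _≡_ _≡_ position
  position-injective {x} {y} eq = begin
    x                      ≡⟨ sym (inverseʳ σ) ⟩
    σ ⟨$⟩ʳ (σ ⟨$⟩ˡ x)     ≡⟨ cong (σ ⟨$⟩ʳ_) (toℕ-injective eq) ⟩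
    σ ⟨$⟩ʳ (σ ⟨$⟩ˡ y)     ≡⟨ inverseʳ σ ⟩
    y                      ∎
    where open ≡-Reasoning

  IsFirst-unique : ∀ {x y} → IsFirst σ x → IsFirst σ y → x ≡ y
  IsFirst-unique x-first y-first = position-injective (trans x-first (sym y-first))

  module _ {k : ℕ} (π : Fin (suc (suc k)) → Fin (suc n)) (accepts : Accepts (chain π) σ) where

    accepts-chain⇒stride : ∀ b → position (π zero) + toℕ b ≤ position (π b)
    accepts-chain⇒stride = increasing⇒stride (λ b → position (π b))
      (VecAll.tabulate⁻ (VecAll.toList⁻ {xs = tabulate (links π)} accepts))

    IsFirst-chain⇒head : ∀ {b x} → π b ≡ x → IsFirst σ x → x ≡ π zero
    IsFirst-chain⇒head {zero}  refl _ = refl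
    IsFirst-chain⇒head {suc b} refl b-first
      with m+n≤o⇒n≤o (position (π zero)) (≤-trans (accepts-chain⇒stride (suc b)) (≤-reflexive b-first))
    ... | ()

    IsSecond-chain⇒second : ∀ {b x} → π (suc b) ≡ x → IsSecond σ x → b ≡ zero × IsFirst σ (π zero)
    IsSecond-chain⇒second {b} refl b-second
      with ≤-trans (accepts-chain⇒stride (suc b)) (≤-reflexive b-second)
    IsSecond-chain⇒second {zero}  refl _ | stride = refl , n≤0⇒n≡0 (+-cancelʳ-≤ 1 (position (π zero)) 0 stride)
    IsSecond-chain⇒second {suc b} refl _ | stride with m+n≤o⇒n≤o (position (π zero)) stride
    ... | s≤s ()

lemma4p7 : ∀ {n} (D : DNF n) → Normalized D →
    ∀ {t} → t ∈ D →
    ∀ {k} (π : Fin (suc (suc k)) → Fin (suc n)) → Injective _≡_ _≡_ π → t ≡ chain π →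
    ∀ (σ : TotalOrder n) → Accepts t σ →
      (IsFirst σ zero → π zero ≡ zero)
      × (∀ (i : Fin (suc n)) → i ≢ zero → IsFirst σ i → IsSecond σ zero →
           (π zero ≡ zero × ¬ InImage π i) ⊎ (π zero ≡ i × π (suc zero) ≡ zero))
lemma4p7 D normalized t∈D π _ t≡chain σ accepts-t = first-is-zero , second-is-zero
  where
  accepts : Accepts (chain π) σ
  accepts = subst (λ t → Accepts t σ) t≡chain accepts-t

  zero∈π : InImage π zero
  zero∈π = Normalized⇒zero∈image normalized t∈D t≡chain

  first-is-zero : IsFirst σ zero → π zero ≡ zero
  first-is-zero zero-first with zero∈π
  ... | _ , πa≡0 = sym (IsFirst-chain⇒head σ π accepts πa≡0 zero-first)

  second-is-zero : ∀ i → i ≢ zero → IsFirst σ i → IsSecond σ zero →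
                   (π zero ≡ zero × ¬ InImage π i) ⊎ (π zero ≡ i × π (suc zero) ≡ zero)
  second-is-zero i i≢0 i-first zero-second with zero∈π
  ... | zero , π0≡0 =
    inj₁ (π0≡0 , λ (_ , πb≡i) → i≢0 (trans (IsFirst-chain⇒head σ π accepts πb≡i i-first) π0≡0))
  ... | suc _ , πa+1≡0 with IsSecond-chain⇒second σ π accepts πa+1≡0 zero-second
  ...   | refl , π0-first = inj₂ (IsFirst-unique σ π0-first i-first , πa+1≡0)
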